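{- Let $\mathbb F$ be a field and $\beta,\gamma,\gamma^*,\varrho,\varrho^*\in\mathbb F$. For distinct $r,s\in\{1,2,3\}$, the algebra homomorphism $T(\beta,\gamma,\gamma^*,\varrho,\varrho^*)\to\mathbb T(\beta,\gamma,\gamma^*,\varrho,\varrho^*)$ sending $A\mapsto A_r$ and $A^*\mapsto A^*_s$ is injective.
   Context: $T(\beta,\gamma,\gamma^*,\varrho,\varrho^*)$ (the tridiagonal algebra) is the associative unital $\mathbb F$-algebra with generators $A,A^*$ and relations $[A,A^2A^*-\beta AA^*A+A^*A^2-\gamma(AA^*+A^*A)-\varrho A^*]=0$ and $[A^*,A^{*2}A-\beta A^*AA^*+AA^{*2}-\gamma^*(A^*A+AA^*)-\varrho^*A]=0$, with $[B,C]=BC-CB$. $\mathbb T(\beta,\gamma,\gamma^*,\varrho,\varrho^*)$ is the associative unital $\mathbb F$-algebra with generators $A_i,A^*_i$ ($i\in\{1,2,3\}$) and relations $[A_i,A_j]=0$, $[A^*_i,A^*_j]=0$ for all $i,j$; $[A_i,A^*_i]=0$ for all $i$; and for distinct $i,j$: $[A_i,A_i^2A_j^*-\beta A_iA_j^*A_i+A_j^*A_i^2-\gamma(A_iA_j^*+A_j^*A_i)-\varrho A_j^*]=0$ and $[A_j^*,A_j^{*2}A_i-\beta A_j^*A_iA_j^*+A_iA_j^{*2}-\gamma^*(A_j^*A_i+A_iA_j^*)-\varrho^*A_i]=0$. (The homomorphism exists since the relations of $T$ map to relations of $\mathbb T$.) -}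

module Defs where

open import Level using (Level; _⊔_) renaming (suc to lsuc)
open import Algebra.Bundles using (CommutativeRing)
open import Data.Product using (∃)
open import Data.Fin using (Fin)
open import Relation.Nullary using (¬_)
open import Relation.Binary.PropositionalEquality using (_≢_)

record Field (c ℓ : Level) : Set (lsuc (c ⊔ ℓ)) where
  field
    commutativeRing : CommutativeRing c ℓ
  open CommutativeRing commutativeRing public
  field
    0≉1     : ¬ (0# ≈ 1#)
    inverse : ∀ x → ¬ (x ≈ 0#) → ∃ λ y → x * y ≈ 1#

-- Free associative unital F-algebra on a set X of generators, given by
-- terms, and algebras presented by generators and relations, given as
-- the quotient of the term syntax by the congruence generated by the
-- unital-associative-F-algebra axioms and the relations (rel r = 0).

module FreeAlgebra {c ℓ : Level} (F : Field c ℓ) where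
  open Field F

  infixl 6 _⊕_
  infixl 7 _⊗_

  data Term (X : Set) : Set c where
    var : X → Term X
    κ   : Carrier → Term X          -- scalar a · 1
    _⊕_ : Term X → Term X → Term X
    _⊗_ : Term X → Term X → Term X

  -- substitution of generators = the algebra homomorphism F⟨X⟩ → F⟨Y⟩
  -- determined by the images of the generators
  subst : {X Y : Set} → (X → Term Y) → Term X → Term Y
  subst σ (var x) = σ x
  subst σ (κ a)   = κ a
  subst σ (t ⊕ u) = subst σ t ⊕ subst σ u
  subst σ (t ⊗ u) = subst σ t ⊗ subst σ u

  module _ {X : Set} where
    infixl 6 _⊖_
    infixr 8 _·_

    _⊖_ : Term X → Term X → Term X
    t ⊖ u = t ⊕ κ (- 1#) ⊗ u

    _·_ : Carrier → Term X → Term X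
    a · t = κ a ⊗ t

    [_,_] : Term X → Term X → Term X
    [ t , u ] = t ⊗ u ⊖ u ⊗ t

  module Presented {X R : Set} (rel : R → Term X) where
    infix 4 _≋_
    data _≋_ : Term X → Term X → Set (c ⊔ ℓ) where
      ≋-refl  : ∀ {t} → t ≋ t
      ≋-sym   : ∀ {t u} → t ≋ u → u ≋ t
      ≋-trans : ∀ {t u v} → t ≋ u → u ≋ v → t ≋ v
      ⊕-cong  : ∀ {t t′ u u′} → t ≋ t′ → u ≋ u′ → t ⊕ u ≋ t′ ⊕ u′
      ⊗-cong  : ∀ {t t′ u u′} → t ≋ t′ → u ≋ u′ → t ⊗ u ≋ t′ ⊗ u′
      -- scalars: F → algebra is a unital ring map with central image
      κ-cong  : ∀ {a b} → a ≈ b → κ a ≋ κ b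
      κ-+     : ∀ a b → κ (a + b) ≋ κ a ⊕ κ b
      κ-*     : ∀ a b → κ (a * b) ≋ κ a ⊗ κ b
      κ-central : ∀ a t → κ a ⊗ t ≋ t ⊗ κ a
      -- ring axioms (0 = κ 0#, 1 = κ 1#, -t = κ (- 1#) ⊗ t)
      ≋⊕-assoc : ∀ t u v → (t ⊕ u) ⊕ v ≋ t ⊕ (u ⊕ v)
      ≋⊕-comm  : ∀ t u → t ⊕ u ≋ u ⊕ t
      ≋⊕-identityˡ : ∀ t → κ 0# ⊕ t ≋ t
      ≋⊕-inverseʳ  : ∀ t → t ⊕ κ (- 1#) ⊗ t ≋ κ 0#
      ≋⊗-assoc : ∀ t u v → (t ⊗ u) ⊗ v ≋ t ⊗ (u ⊗ v)
      ≋⊗-identityˡ : ∀ t → κ 1# ⊗ t ≋ t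
      ≋⊗-identityʳ : ∀ t → t ⊗ κ 1# ≋ t
      ≋distribˡ : ∀ t u v → t ⊗ (u ⊕ v) ≋ t ⊗ u ⊕ t ⊗ v
      ≋distribʳ : ∀ t u v → (u ⊕ v) ⊗ t ≋ u ⊗ t ⊕ v ⊗ t
      relation : ∀ r → rel r ≋ κ 0#

  module Tridiagonal (β γ γ* ϱ ϱ* : Carrier) where
    TD₁ : {X : Set} → Term X → Term X → Term X
    TD₁ x y = [ x , x ⊗ x ⊗ y ⊖ β · (x ⊗ y ⊗ x) ⊕ y ⊗ x ⊗ x
                    ⊖ γ · (x ⊗ y ⊕ y ⊗ x) ⊖ ϱ · y ]
    TD₂ : {X : Set} → Term X → Term X → Term X
    TD₂ x y = [ y , y ⊗ y ⊗ x ⊖ β · (y ⊗ x ⊗ y) ⊕ x ⊗ y ⊗ y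
                    ⊖ γ* · (y ⊗ x ⊕ x ⊗ y) ⊖ ϱ* · x ]

    data TGen : Set where
      A A* : TGen

    data TRel : Set where
      r₁ r₂ : TRel

    Trel : TRel → Term TGen
    Trel r₁ = TD₁ (var A) (var A*)
    Trel r₂ = TD₂ (var A) (var A*)

    module T = Presented Trel

    data 𝕋Gen : Set where
      𝔸 𝔸* : Fin 3 → 𝕋Gen

    data 𝕋Rel : Set where
      comm   : Fin 3 → Fin 3 → 𝕋Rel
      comm*  : Fin 3 → Fin 3 → 𝕋Rel
      commd  : Fin 3 → 𝕋Rel
      td₁    : (i j : Fin 3) → i ≢ j → 𝕋Rel
      td₂    : (i j : Fin 3) → i ≢ j → 𝕋Rel

    𝕋rel : 𝕋Rel → Term 𝕋Gen
    𝕋rel (comm i j)    = [ var (𝔸 i) , var (𝔸 j) ]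
    𝕋rel (comm* i j)   = [ var (𝔸* i) , var (𝔸* j) ]
    𝕋rel (commd i)     = [ var (𝔸 i) , var (𝔸* i) ]
    𝕋rel (td₁ i j _)   = TD₁ (var (𝔸 i)) (var (𝔸* j))
    𝕋rel (td₂ i j _)   = TD₂ (var (𝔸 i)) (var (𝔸* j))

    module 𝕋 = Presented 𝕋rel

    ι : Fin 3 → Fin 3 → TGen → Term 𝕋Gen
    ι r s A  = var (𝔸 r)
    ι r s A* = var (𝔸* s)

{-# OPTIONS --safe #-}
module Submission where

open import Defs
open import Level using (Level; _⊔_)
open import Data.Empty using (⊥-elim)
open import Data.Fin using (Fin; _≟_)
open import Data.Nat using (ℕ)
open import Relation.Binary.PropositionalEquality
  using (_≡_; _≢_; refl; trans; sym; cong₂; subst₂)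
open import Relation.Binary.Bundles using (Setoid)
import Relation.Binary.Reasoning.Setoid as SetoidReasoning
open import Relation.Nullary using (yes; no)

-- The map A ↦ A_r, A* ↦ A*_s has a left inverse 𝕋 → T: send A_r ↦ A,
-- A*_s ↦ A* and every other generator to 0.  This is well defined because
-- every defining relation of 𝕋 either becomes a defining relation of T
-- (the tridiagonal relations for the pair (r, s)) or involves a generator
-- sent to 0, and then vanishes; the only relation that would need both
-- A_r and A*_s is [A_i, A*_i] = 0, which is excluded by r ≠ s.

module _ {c ℓ : Level} (F : Field c ℓ) where
  open Field F using (Carrier; 0#; +-identityˡ) renaming (sym to ≈-sym)
  open FreeAlgebra F

  subst-left-inverse : {X Y : Set} (σ : X → Term Y) (π : Y → Term X) →
                       (∀ x → subst π (σ x) ≡ var x) →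
                       ∀ t → subst π (subst σ t) ≡ t
  subst-left-inverse σ π π∘σ≡var = go
    where
    go : ∀ t → subst π (subst σ t) ≡ t
    go (var x) = π∘σ≡var x
    go (κ a)   = refl
    go (t ⊕ u) = cong₂ _⊕_ (go t) (go u)
    go (t ⊗ u) = cong₂ _⊗_ (go t) (go u)

  module _ {X Y R S : Set} {relˣ : R → Term X} {relʸ : S → Term Y} where
    private
      module 𝑋 = Presented relˣ
      module 𝑌 = Presented relʸ

    subst-cong : (σ : X → Term Y) → (∀ q → subst σ (relˣ q) 𝑌.≋ κ 0#) →
                 ∀ {t u} → t 𝑋.≋ u → subst σ t 𝑌.≋ subst σ u
    subst-cong σ σ-rel = go
      where
      go : ∀ {t u} → t 𝑋.≋ u → subst σ t 𝑌.≋ subst σ u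
      go 𝑋.≋-refl            = 𝑌.≋-refl
      go (𝑋.≋-sym d)         = 𝑌.≋-sym (go d)
      go (𝑋.≋-trans d e)     = 𝑌.≋-trans (go d) (go e)
      go (𝑋.⊕-cong d e)      = 𝑌.⊕-cong (go d) (go e)
      go (𝑋.⊗-cong d e)      = 𝑌.⊗-cong (go d) (go e)
      go (𝑋.κ-cong a≈b)      = 𝑌.κ-cong a≈b
      go (𝑋.κ-+ a b)         = 𝑌.κ-+ a b
      go (𝑋.κ-* a b)         = 𝑌.κ-* a b
      go (𝑋.κ-central a t)   = 𝑌.κ-central a _
      go (𝑋.≋⊕-assoc t u v)  = 𝑌.≋⊕-assoc _ _ _
      go (𝑋.≋⊕-comm t u)     = 𝑌.≋⊕-comm _ _
      go (𝑋.≋⊕-identityˡ t)  = 𝑌.≋⊕-identityˡ _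
      go (𝑋.≋⊕-inverseʳ t)   = 𝑌.≋⊕-inverseʳ _
      go (𝑋.≋⊗-assoc t u v)  = 𝑌.≋⊗-assoc _ _ _
      go (𝑋.≋⊗-identityˡ t)  = 𝑌.≋⊗-identityˡ _
      go (𝑋.≋⊗-identityʳ t)  = 𝑌.≋⊗-identityʳ _
      go (𝑋.≋distribˡ t u v) = 𝑌.≋distribˡ _ _ _
      go (𝑋.≋distribʳ t u v) = 𝑌.≋distribʳ _ _ _
      go (𝑋.relation q)      = σ-rel q

  module _ {X Y R S : Set} {relˣ : R → Term X} {relʸ : S → Term Y} where
    private
      module 𝑋 = Presented relˣ
      module 𝑌 = Presented relʸ

    subst-injective-of-left-inverse :
      (σ : X → Term Y) (π : Y → Term X) →
      (∀ q → subst π (relʸ q) 𝑋.≋ κ 0#) → (∀ x → subst π (σ x) ≡ var x) →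
      ∀ t u → subst σ t 𝑌.≋ subst σ u → t 𝑋.≋ u
    subst-injective-of-left-inverse σ π π-rel π∘σ≡var t u σt≋σu =
      subst₂ 𝑋._≋_ (subst-left-inverse σ π π∘σ≡var t)
                   (subst-left-inverse σ π π∘σ≡var u)
                   (subst-cong π π-rel σt≋σu)

  onlyAt : {X : Set} {n : ℕ} → Fin n → X → Fin n → Term X
  onlyAt k x i with i ≟ k
  ... | yes _ = var x
  ... | no _  = κ 0#

  onlyAt-self : {X : Set} {n : ℕ} (k : Fin n) (x : X) → onlyAt k x k ≡ var x
  onlyAt-self k x with k ≟ k
  ... | yes _ = refl
  ... | no k≢k = ⊥-elim (k≢k refl)

  module PresentedProperties {X R : Set} (rel : R → Term X) where
    open Presented rel

    ≋-setoid : Setoid c (c ⊔ ℓ)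
    ≋-setoid = record
      { Carrier       = Term X
      ; _≈_           = _≋_
      ; isEquivalence = record { refl = ≋-refl ; sym = ≋-sym ; trans = ≋-trans }
      }

    Zero : Term X → Set (c ⊔ ℓ)
    Zero t = t ≋ κ 0#

    zero-unique : ∀ {t} → t ≋ t ⊕ t → Zero t
    zero-unique {t} t≋t⊕t = begin
      t                ≈⟨ ≋-sym (≋⊕-identityˡ t) ⟩
      κ 0# ⊕ t         ≈⟨ ≋⊕-comm (κ 0#) t ⟩
      t ⊕ κ 0#         ≈⟨ ⊕-cong ≋-refl (≋-sym (≋⊕-inverseʳ t)) ⟩
      t ⊕ (t ⊖ t)      ≈⟨ ≋-sym (≋⊕-assoc t t _) ⟩
      (t ⊕ t) ⊖ t      ≈⟨ ⊕-cong (≋-sym t≋t⊕t) ≋-refl ⟩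
      t ⊖ t            ≈⟨ ≋⊕-inverseʳ t ⟩
      κ 0#             ∎
      where open SetoidReasoning ≋-setoid

    κ0≋κ0⊕κ0 : κ 0# ≋ κ 0# ⊕ κ 0#
    κ0≋κ0⊕κ0 = ≋-trans (κ-cong (≈-sym (+-identityˡ 0#))) (κ-+ 0# 0#)

    zeroˡ : ∀ u → Zero (κ 0# ⊗ u)
    zeroˡ u = zero-unique (≋-trans (⊗-cong κ0≋κ0⊕κ0 ≋-refl) (≋distribʳ u _ _))

    zeroʳ : ∀ t → Zero (t ⊗ κ 0#)
    zeroʳ t = zero-unique (≋-trans (⊗-cong ≋-refl κ0≋κ0⊕κ0) (≋distribˡ t _ _))

    ⊗-zeroˡ : ∀ {t u} → Zero t → Zero (t ⊗ u)
    ⊗-zeroˡ {u = u} t≋0 = ≋-trans (⊗-cong t≋0 ≋-refl) (zeroˡ u)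

    ⊗-zeroʳ : ∀ {t u} → Zero u → Zero (t ⊗ u)
    ⊗-zeroʳ {t} u≋0 = ≋-trans (⊗-cong ≋-refl u≋0) (zeroʳ t)

    ⊕-zero : ∀ {t u} → Zero t → Zero u → Zero (t ⊕ u)
    ⊕-zero t≋0 u≋0 = ≋-trans (⊕-cong t≋0 u≋0) (≋⊕-identityˡ _)

    ⊖-zero : ∀ {t u} → Zero t → Zero u → Zero (t ⊖ u)
    ⊖-zero t≋0 u≋0 = ⊕-zero t≋0 (⊗-zeroʳ u≋0)

    [,]-zeroˡ : ∀ {t u} → Zero t → Zero [ t , u ]
    [,]-zeroˡ t≋0 = ⊖-zero (⊗-zeroˡ t≋0) (⊗-zeroʳ t≋0)

    [,]-zeroʳ : ∀ {t u} → Zero u → Zero [ t , u ]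
    [,]-zeroʳ u≋0 = ⊖-zero (⊗-zeroʳ u≋0) (⊗-zeroˡ u≋0)

    [,]-self : ∀ t → Zero [ t , t ]
    [,]-self t = ≋⊕-inverseʳ (t ⊗ t)

    TD₁-zeroʳ : ∀ β γ γ* ϱ ϱ* x → Zero (Tridiagonal.TD₁ β γ γ* ϱ ϱ* x (κ 0#))
    TD₁-zeroʳ β γ γ* ϱ ϱ* x =
      [,]-zeroʳ (⊖-zero (⊖-zero (⊕-zero (⊖-zero (⊗-zeroʳ ≋-refl)
                                                (⊗-zeroʳ (⊗-zeroˡ (⊗-zeroʳ ≋-refl))))
                                        (⊗-zeroˡ (⊗-zeroˡ ≋-refl)))
                                (⊗-zeroʳ (⊕-zero (⊗-zeroʳ ≋-refl) (⊗-zeroˡ ≋-refl))))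
                        (⊗-zeroʳ ≋-refl))

    -- TD₂ x y is, definitionally, TD₁ y x with γ, ϱ replaced by γ*, ϱ*.
    TD₂-zeroˡ : ∀ β γ γ* ϱ ϱ* y → Zero (Tridiagonal.TD₂ β γ γ* ϱ ϱ* (κ 0#) y)
    TD₂-zeroˡ β γ γ* ϱ ϱ* = TD₁-zeroʳ β γ* γ ϱ* ϱ

    onlyAt-commute : {n : ℕ} (k : Fin n) (x : X) →
                     ∀ i j → Zero [ onlyAt k x i , onlyAt k x j ]
    onlyAt-commute k x i j with i ≟ k | j ≟ k
    ... | yes _ | yes _ = [,]-self (var x)
    ... | yes _ | no _  = [,]-zeroʳ ≋-refl
    ... | no _  | _     = [,]-zeroˡ ≋-refl

  module Projection (β γ γ* ϱ ϱ* : Carrier) {r s : Fin 3} (r≢s : r ≢ s) where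
    open Tridiagonal β γ γ* ϱ ϱ*
    open PresentedProperties Trel
    open T using (≋-refl; relation)

    π : 𝕋Gen → Term TGen
    π (𝔸 i)  = onlyAt r A i
    π (𝔸* i) = onlyAt s A* i

    π-relations : ∀ q → Zero (subst π (𝕋rel q))
    π-relations (comm i j)  = onlyAt-commute r A i j
    π-relations (comm* i j) = onlyAt-commute s A* i j
    π-relations (commd i) with i ≟ r | i ≟ s
    ... | yes i≡r | yes i≡s = ⊥-elim (r≢s (trans (sym i≡r) i≡s))
    ... | yes _   | no _    = [,]-zeroʳ ≋-refl
    ... | no _    | _       = [,]-zeroˡ ≋-refl
    π-relations (td₁ i j _) with i ≟ r | j ≟ s
    ... | yes _ | yes _ = relation r₁
    ... | _     | no _  = TD₁-zeroʳ β γ γ* ϱ ϱ* _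
    ... | no _  | yes _ = [,]-zeroˡ ≋-refl
    π-relations (td₂ i j _) with i ≟ r | j ≟ s
    ... | yes _ | yes _ = relation r₂
    ... | no _  | _     = TD₂-zeroˡ β γ γ* ϱ ϱ* _
    ... | yes _ | no _  = [,]-zeroˡ ≋-refl

    π∘ι≡var : ∀ g → subst π (ι r s g) ≡ var g
    π∘ι≡var A  = onlyAt-self r A
    π∘ι≡var A* = onlyAt-self s A*

lemma4p4 : ∀ {c ℓ} (F : Field c ℓ) → let open Field F in let open FreeAlgebra F in
             (β γ γ* ϱ ϱ* : Carrier) → let open Tridiagonal β γ γ* ϱ ϱ* in
             (r s : Fin 3) → r ≢ s →
             ∀ (t u : Term TGen) →
             𝕋._≋_ (subst (ι r s) t) (subst (ι r s) u) → T._≋_ t u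
lemma4p4 F β γ γ* ϱ ϱ* r s r≢s =
  subst-injective-of-left-inverse F (ι r s) π π-relations π∘ι≡var
  where
  open FreeAlgebra.Tridiagonal F β γ γ* ϱ ϱ* using (ι)
  open Projection F β γ γ* ϱ ϱ* r≢s
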